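{- Let $A$ be a residuated lattice. (1) For every filter $F$ of $A$: $F$ has BLP iff the congruence $\sim_F$ has CBLP. (2) $A$ has BLP iff $A$ has CBLP.
   Context: A residuated lattice is an algebra $(A,\vee,\wedge,\odot,\to,0,1)$ such that $(A,\vee,\wedge,0,1)$ is a bounded lattice, $(A,\odot,1)$ is a commutative monoid, and $a\le b\to c$ iff $a\odot b\le c$. Let $a\leftrightarrow b=(a\to b)\wedge(b\to a)$. A filter of $A$ is a non-empty $F\subseteq A$ closed under $\odot$ and upward closed. For a filter $F$, $\sim_F$ is the congruence $x\sim_F y$ iff $x\leftrightarrow y\in F$; $A/F$ is the quotient residuated lattice and $p_F:A\to A/F$ the canonical morphism. $\mathcal{B}(A)$ denotes the Boolean algebra of complemented elements of the underlying bounded lattice of $A$, and $p_F$ restricts to a Boolean morphism $\mathcal{B}(p_F):\mathcal{B}(A)\to\mathcal{B}(A/F)$. $F$ (equivalently $\sim_F$) has BLP iff $\mathcal{B}(p_F)$ is surjective; $A$ has BLP iff every filter has BLP. Residuated lattices are congruence-distributive and ${\rm Con}(A)$ has compact top element. For a congruence $\theta$ of $A$, $u_\theta:{\rm Con}(A)\to{\rm Con}(A/\theta)$, $u_\theta(\alpha)=(\alpha\vee\theta)/\theta$ (with $\phi/\theta=\{(a/\theta,b/\theta)\mid(a,b)\in\phi\}$); $\theta$ has CBLP iff the restriction of $u_\theta$ mapping $\mathcal{B}({\rm Con}(A))$ (Boolean center of the congruence lattice) to $\mathcal{B}({\rm Con}(A/\theta))$ is surjective; $A$ has CBLP iff every congruence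 has CBLP. -}

module Defs where

open import Level using (Level; _⊔_; suc)
open import Algebra.Core using (Op₂)
open import Algebra.Definitions using (Congruent₂)
open import Algebra.Structures using (IsCommutativeMonoid)
open import Algebra.Lattice.Structures using (IsLattice)
open import Relation.Binary.Core using (Rel)
open import Relation.Binary.Structures using (IsEquivalence)
open import Relation.Unary using (Pred)
open import Data.Product using (Σ; ∃; _×_)

-- Residuated lattices (over a setoid; quotients are modelled by
-- replacing the equality relation).  x ≤ y is the lattice order
-- x ∧ y ≈ x.

record ResiduatedLattice (c ℓ : Level) : Set (suc (c ⊔ ℓ)) where
  infixr 5 _⇒_
  infixl 7 _⊙_
  infixr 6 _∨_
  infixr 7 _∧_
  infix 4 _≈_
  field
    Carrier : Set c
    _≈_ : Rel Carrier ℓ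
    _∨_ _∧_ _⊙_ _⇒_ : Op₂ Carrier
    0# 1# : Carrier
    isLattice : IsLattice _≈_ _∨_ _∧_
    ⊙-isCommutativeMonoid : IsCommutativeMonoid _≈_ _⊙_ 1#
    ⇒-cong : Congruent₂ _≈_ _⇒_
    0#-least : ∀ x → (0# ∧ x) ≈ 0#
    1#-greatest : ∀ x → (x ∧ 1#) ≈ x
    residuated : ∀ x y z → ((x ∧ (y ⇒ z)) ≈ x → ((x ⊙ y) ∧ z) ≈ (x ⊙ y))
                         × (((x ⊙ y) ∧ z) ≈ (x ⊙ y) → (x ∧ (y ⇒ z)) ≈ x)

  infix 4 _≤_
  _≤_ : Rel Carrier ℓ
  x ≤ y = (x ∧ y) ≈ x

  infix 5 _⇔_
  _⇔_ : Op₂ Carrier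
  x ⇔ y = (x ⇒ y) ∧ (y ⇒ x)

module _ {c ℓ : Level} (A : ResiduatedLattice c ℓ) where
  open ResiduatedLattice A

  private
    L : Level
    L = c ⊔ ℓ

  record Filter : Set (suc L) where
    field
      F : Pred Carrier L
      nonempty : ∃ F
      ⊙-closed : ∀ x y → F x → F y → F (x ⊙ y)
      up-closed : ∀ x y → F x → x ≤ y → F y

  ∼[_] : Filter → Rel Carrier L
  ∼[ 𝔽 ] x y = Filter.F 𝔽 (x ⇔ y)

  -- x is a complemented element of the bounded lattice (A, E),
  -- where E is the equality (≈ for A itself, ∼_F for A/F)
  Complemented : ∀ {e} → Rel Carrier e → Pred Carrier (c ⊔ e)
  Complemented E x = ∃ λ y → E (x ∨ y) 1# × E (x ∧ y) 0#

  -- F has BLP: B(p_F) : B(A) → B(A/F), x ↦ x/F, is surjective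
  BLP : Filter → Set L
  BLP 𝔽 = ∀ y → Complemented ∼[ 𝔽 ] y
              → ∃ λ x → Complemented _≈_ x × ∼[ 𝔽 ] x y

  HasBLP : Set (suc L)
  HasBLP = ∀ (𝔽 : Filter) → BLP 𝔽

  Compatible : Rel Carrier L → Set L
  Compatible R = ∀ {x y u v} → R x y → R u v →
      R (x ∨ u) (y ∨ v) × R (x ∧ u) (y ∧ v)
    × R (x ⊙ u) (y ⊙ v) × R (x ⇒ u) (y ⇒ v)

  -- congruences of the algebra (Carrier, E, ∨, ∧, ⊙, ⇒, 0, 1):
  -- for E = ≈ these are the congruences of A, for E = θ they are the
  -- congruences of A/θ
  record CongOver {e} (E : Rel Carrier e) : Set (suc L ⊔ e) where
    field
      rel : Rel Carrier L
      isEquivalence : IsEquivalence rel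
      contains : ∀ {x y} → E x y → rel x y
      compatible : Compatible rel

  open CongOver public

  Congruence : Set (suc L)
  Congruence = CongOver _≈_

  -- R is in the Boolean center of Con(A/E): it has a complement S with
  -- R ∧ S = Δ (the equality E) and R ∨ S = ∇ (every upper bound of R, S
  -- in Con(A/E) is the total relation)
  ComplementedCon : ∀ {e} (E : Rel Carrier e) → CongOver E → Set (suc L ⊔ e)
  ComplementedCon E R = Σ (CongOver E) λ S →
      (∀ x y → rel R x y → rel S x y → E x y)
    × (∀ (γ : CongOver E) → (∀ x y → rel R x y → rel γ x y)
                          → (∀ x y → rel S x y → rel γ x y)
                          → ∀ x y → rel γ x y)

  IsJoin : Congruence → Rel Carrier L → Rel Carrier L → Set (suc L)
  IsJoin α θ β =
      (∀ x y → rel α x y → β x y)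
    × (∀ x y → θ x y → β x y)
    × (∀ (γ : Congruence) → (∀ x y → rel α x y → rel γ x y)
                          → (∀ x y → θ x y → rel γ x y)
                          → ∀ x y → β x y → rel γ x y)

  -- θ has CBLP: u_θ restricted to B(Con A) → B(Con (A/θ)) is surjective,
  -- where u_θ(α) = (α ∨ θ)/θ, which as a relation on the carrier is α ∨ θ.
  CBLP : Rel Carrier L → Set (suc L)
  CBLP θ = ∀ (β : CongOver θ) → ComplementedCon θ β
         → Σ Congruence λ α → ComplementedCon _≈_ α × IsJoin α θ (rel β)

  HasCBLP : Set (suc L)
  HasCBLP = ∀ (θ : Congruence) → CBLP (rel θ)

module Submission where

-- A congruence is determined by its class of 1#, which is a filter,
-- and the join of ∼F and ∼G is ∼(F ⊔ G).  Through this correspondence a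
-- complemented pair β, S of congruences above ∼F is witnessed by g ∈ 1/β and
-- h ∈ 1/S with g ⊙ h ≤ 0# and g ∨ h ∈ F, i.e. by an element g complemented
-- modulo F; conversely, y complemented modulo F with complement z gives the
-- complemented pair of congruences of {w | z ∨ w ∈ F} and {w | y ∨ w ∈ F}.
-- For F = {1#} these are the complemented congruences of A, generated by
-- complemented elements of A.  Lifting complemented elements of A/F and
-- lifting complemented congruences of A/∼F thus translate into each other.

open import Level using (Level; _⊔_; Lift; lift; lower)
open import Defs
open import Data.Product using (_×_; _,_; proj₁; proj₂; ∃-syntax)
open import Function.Bundles using (_⇔_; mk⇔)
open import Relation.Binary.Core using (Rel)
open import Relation.Binary.Structures using (IsEquivalence; IsPartialOrder)
open import Relation.Binary.Bundles using (Poset)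
open import Algebra.Bundles using (CommutativeMonoid)
open import Algebra.Structures using (IsCommutativeMonoid)
open import Algebra.Lattice.Structures using (IsLattice)
open import Algebra.Lattice.Bundles using (Lattice)
import Algebra.Lattice.Properties.Lattice as LatticeProperties
import Algebra.Properties.CommutativeSemigroup as CommutativeSemigroupProperties
import Relation.Binary.Lattice.Structures as OrderLattice
import Relation.Binary.Reasoning.PartialOrder as PosetReasoning

module _ {c ℓ : Level} (A : ResiduatedLattice c ℓ) where
  open ResiduatedLattice A renaming (_⇔_ to _⟺_)
  open IsLattice isLattice
    using (∧-comm; ∨-comm)
    renaming (isEquivalence to ≈-isEquivalence; refl to ≈-refl; sym to ≈-sym; trans to ≈-trans)
  open IsCommutativeMonoid ⊙-isCommutativeMonoid
    using () renaming (assoc to ⊙-assoc; comm to ⊙-comm; identityˡ to ⊙-identityˡ;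
                       identityʳ to ⊙-identityʳ; ∙-cong to ⊙-cong; ∙-congˡ to ⊙-congˡ)

  ⊙-monoid : CommutativeMonoid c ℓ
  ⊙-monoid = record { isCommutativeMonoid = ⊙-isCommutativeMonoid }
  open CommutativeSemigroupProperties (CommutativeMonoid.commutativeSemigroup ⊙-monoid)
    using (interchange; xy∙z≈y∙xz; xy∙z≈xz∙y)

  -- The library orders a lattice by x ≈ x ∧ y; the
  -- order x ∧ y ≈ x of a residuated lattice is its symmetric reading, so
  -- all order-theoretic facts are imported through ≈-sym.

  private
    lattice : Lattice c ℓ
    lattice = record { isLattice = isLattice }
    open OrderLattice.IsLattice (LatticeProperties.∨-∧-isOrderTheoreticLattice lattice)
      using (x≤x∨y; y≤x∨y; ∨-least; x∧y≤x; x∧y≤y; ∧-greatest)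
      renaming (reflexive to lib-reflexive; trans to lib-trans; antisym to lib-antisym)

  ≤-isPartialOrder : IsPartialOrder _≈_ _≤_
  ≤-isPartialOrder = record
    { isPreorder = record
      { isEquivalence = ≈-isEquivalence
      ; reflexive = λ x≈y → ≈-sym (lib-reflexive x≈y)
      ; trans = λ p q → ≈-sym (lib-trans (≈-sym p) (≈-sym q)) }
    ; antisym = λ p q → lib-antisym (≈-sym p) (≈-sym q) }

  ≤-poset : Poset c ℓ ℓ
  ≤-poset = record { isPartialOrder = ≤-isPartialOrder }

  open Poset ≤-poset using ()
    renaming (refl to ≤-refl; reflexive to ≈⇒≤; trans to ≤-trans; antisym to ≤-antisym)

  ∧-lowerˡ : ∀ {x y} → x ∧ y ≤ x
  ∧-lowerˡ {x} {y} = ≈-sym (x∧y≤x x y)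

  ∧-lowerʳ : ∀ {x y} → x ∧ y ≤ y
  ∧-lowerʳ {x} {y} = ≈-sym (x∧y≤y x y)

  ∧-greatest′ : ∀ {x y z} → z ≤ x → z ≤ y → z ≤ x ∧ y
  ∧-greatest′ p q = ≈-sym (∧-greatest (≈-sym p) (≈-sym q))

  ∨-upperˡ : ∀ {x y} → x ≤ x ∨ y
  ∨-upperˡ {x} {y} = ≈-sym (x≤x∨y x y)

  ∨-upperʳ : ∀ {x y} → y ≤ x ∨ y
  ∨-upperʳ {x} {y} = ≈-sym (y≤x∨y x y)

  ∨-least′ : ∀ {x y z} → x ≤ z → y ≤ z → x ∨ y ≤ z
  ∨-least′ p q = ≈-sym (∨-least (≈-sym p) (≈-sym q))

  ∨-mono : ∀ {x x′ y y′} → x ≤ x′ → y ≤ y′ → x ∨ y ≤ x′ ∨ y′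
  ∨-mono p q = ∨-least′ (≤-trans p ∨-upperˡ) (≤-trans q ∨-upperʳ)

  ≤⇒∨≈ : ∀ {x y} → x ≤ y → x ∨ y ≈ y
  ≤⇒∨≈ p = ≤-antisym (∨-least′ p ≤-refl) ∨-upperʳ

  0≤ : ∀ {x} → 0# ≤ x
  0≤ {x} = 0#-least x

  ≤1 : ∀ {x} → x ≤ 1#
  ≤1 {x} = 1#-greatest x

  residual→ : ∀ {x y z} → x ≤ y ⇒ z → x ⊙ y ≤ z
  residual→ {x} {y} {z} = proj₁ (residuated x y z)

  residual← : ∀ {x y z} → x ⊙ y ≤ z → x ≤ y ⇒ z
  residual← {x} {y} {z} = proj₂ (residuated x y z)

  modus-ponens : ∀ {x y} → (x ⇒ y) ⊙ x ≤ y
  modus-ponens = residual→ ≤-refl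

  modus-ponensʳ : ∀ {x y} → x ⊙ (x ⇒ y) ≤ y
  modus-ponensʳ {x} {y} = ≤-trans (≈⇒≤ (⊙-comm x (x ⇒ y))) modus-ponens

  ⊙-monoˡ : ∀ {x x′ y} → x ≤ x′ → x ⊙ y ≤ x′ ⊙ y
  ⊙-monoˡ p = residual→ (≤-trans p (residual← ≤-refl))

  ⊙-monoʳ : ∀ {x y y′} → y ≤ y′ → x ⊙ y ≤ x ⊙ y′
  ⊙-monoʳ {x} {y} {y′} p = begin
    x ⊙ y   ≈⟨ ⊙-comm x y ⟩
    y ⊙ x   ≤⟨ ⊙-monoˡ p ⟩
    y′ ⊙ x  ≈⟨ ⊙-comm y′ x ⟩
    x ⊙ y′  ∎
    where open PosetReasoning ≤-poset

  ⊙-mono : ∀ {x x′ y y′} → x ≤ x′ → y ≤ y′ → x ⊙ y ≤ x′ ⊙ y′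
  ⊙-mono p q = ≤-trans (⊙-monoˡ p) (⊙-monoʳ q)

  -- ⊙ lies below ∧, since 1# is the top element and the unit of ⊙.
  ⊙-lowerˡ : ∀ {x y} → x ⊙ y ≤ x
  ⊙-lowerˡ {x} = ≤-trans (⊙-monoʳ ≤1) (≈⇒≤ (⊙-identityʳ x))

  ⊙-lowerʳ : ∀ {x y} → x ⊙ y ≤ y
  ⊙-lowerʳ {x} {y} = ≤-trans (≈⇒≤ (⊙-comm x y)) ⊙-lowerˡ

  ⊙≤∧ : ∀ {x y} → x ⊙ y ≤ x ∧ y
  ⊙≤∧ = ∧-greatest′ ⊙-lowerˡ ⊙-lowerʳ

  ⊙-distribˡ-∨ : ∀ {x y z} → x ⊙ (y ∨ z) ≤ (x ⊙ y) ∨ (x ⊙ z)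
  ⊙-distribˡ-∨ {x} {y} {z} = ≤-trans (≈⇒≤ (⊙-comm x (y ∨ z)))
    (residual→ (∨-least′ (residual← (≤-trans (≈⇒≤ (⊙-comm y x)) ∨-upperˡ))
                         (residual← (≤-trans (≈⇒≤ (⊙-comm z x)) ∨-upperʳ))))

  1≤⇒-intro : ∀ {x y} → x ≤ y → 1# ≤ x ⇒ y
  1≤⇒-intro {x} p = residual← (≤-trans (≈⇒≤ (⊙-identityˡ x)) p)

  1≤⇒-elim : ∀ {x y} → 1# ≤ x ⇒ y → x ≤ y
  1≤⇒-elim {x} p = ≤-trans (≈⇒≤ (≈-sym (⊙-identityˡ x))) (residual→ p)

  ⇒-self : ∀ {x} → x ⇒ x ≈ 1#
  ⇒-self = ≤-antisym ≤1 (1≤⇒-intro ≤-refl)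

  0⇒-top : ∀ {x y} → x ≤ 0# ⇒ y
  0⇒-top = residual← (≤-trans ⊙-lowerʳ 0≤)

  ≈⇒1≤⟺ : ∀ {x y} → x ≈ y → 1# ≤ x ⟺ y
  ≈⇒1≤⟺ x≈y = ∧-greatest′ (1≤⇒-intro (≈⇒≤ x≈y)) (1≤⇒-intro (≈⇒≤ (≈-sym x≈y)))

  1≤⟺⇒≈ : ∀ {x y} → 1# ≤ x ⟺ y → x ≈ y
  1≤⟺⇒≈ p = ≤-antisym (1≤⇒-elim (≤-trans p ∧-lowerˡ)) (1≤⇒-elim (≤-trans p ∧-lowerʳ))

  ≤⟺1 : ∀ {x} → x ≤ x ⟺ 1#
  ≤⟺1 {x} = ∧-greatest′ (residual← ≤1) (residual← (≈⇒≤ (⊙-identityʳ x)))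

  ⟺1≤ : ∀ {x} → x ⟺ 1# ≤ x
  ⟺1≤ {x} = ≤-trans ∧-lowerʳ (≤-trans (≈⇒≤ (≈-sym (⊙-identityʳ (1# ⇒ x)))) modus-ponens)

  split : ∀ {a b x} → a ∨ b ≈ 1# → x ≤ (x ⊙ a) ∨ (x ⊙ b)
  split {a} {b} {x} a∨b≈1 = begin
    x                    ≈⟨ ⊙-identityʳ x ⟨
    x ⊙ 1#               ≈⟨ ⊙-congˡ a∨b≈1 ⟨
    x ⊙ (a ∨ b)          ≤⟨ ⊙-distribˡ-∨ ⟩
    (x ⊙ a) ∨ (x ⊙ b)    ∎
    where open PosetReasoning ≤-poset

  annihilate : ∀ {x q a} → x ⊙ q ≤ 0# → x ⊙ (q ∨ a) ≤ a
  annihilate x⊙q≤0 = ≤-trans ⊙-distribˡ-∨ (∨-least′ (≤-trans x⊙q≤0 0≤) ⊙-lowerʳ)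

  below-if-covers : ∀ {x q w} → x ⊙ q ≤ 0# → 1# ≤ q ∨ w → x ≤ w
  below-if-covers {x} x⊙q≤0 1≤q∨w =
    ≤-trans (≈⇒≤ (≈-sym (⊙-identityʳ x))) (≤-trans (⊙-monoʳ 1≤q∨w) (annihilate x⊙q≤0))

  ∨-⊙-distrib : ∀ {t a b} → (t ∨ a) ⊙ (t ∨ b) ≤ t ∨ (a ⊙ b)
  ∨-⊙-distrib {t} {a} {b} = ≤-trans ⊙-distribˡ-∨ (∨-least′ (≤-trans ⊙-lowerʳ ∨-upperˡ)
    (≤-trans (≈⇒≤ (⊙-comm (t ∨ a) b)) (≤-trans ⊙-distribˡ-∨
      (∨-least′ (≤-trans ⊙-lowerʳ ∨-upperˡ) (≤-trans (≈⇒≤ (⊙-comm b a)) ∨-upperʳ)))))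

  -- If g ⊙ h ≤ 0#, then g ∨ h certifies that g ∧ h and 0# are equivalent:
  -- (g ∧ h) ⊙ (g ∨ h) ≤ g ⊙ h.
  join≤meet⟺0 : ∀ {g h} → g ⊙ h ≤ 0# → g ∨ h ≤ (g ∧ h) ⟺ 0#
  join≤meet⟺0 {g} {h} g⊙h≤0 = ∧-greatest′ (residual← (≤-trans meet⊙join≤ g⊙h≤0)) 0⇒-top
    where
    meet⊙join≤ : (g ∨ h) ⊙ (g ∧ h) ≤ g ⊙ h
    meet⊙join≤ = ≤-trans (≈⇒≤ (⊙-comm (g ∨ h) (g ∧ h))) (≤-trans ⊙-distribˡ-∨
      (∨-least′ (≤-trans (⊙-monoˡ ∧-lowerʳ) (≈⇒≤ (⊙-comm h g))) (⊙-monoˡ ∧-lowerˡ)))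

  -- Two consequences of the fact that (y ∧ z) ⇒ 0# annihilates y ∧ z: the
  -- filters {w | z ∨ w ∈ F} and {w | y ∨ w ∈ F} meet in F, and z ∨ a ∈ F
  -- forces y ⇒ a ∈ F, whenever (y ∧ z) ⇒ 0# ∈ F.
  relative-meet : ∀ {y z w} → ((y ∧ z) ⇒ 0#) ⊙ ((z ∨ w) ⊙ (y ∨ w)) ≤ w
  relative-meet {y} {z} {w} = begin
    ((y ∧ z) ⇒ 0#) ⊙ ((z ∨ w) ⊙ (y ∨ w))  ≈⟨ ⊙-congˡ (⊙-cong (∨-comm z w) (∨-comm y w)) ⟩
    ((y ∧ z) ⇒ 0#) ⊙ ((w ∨ z) ⊙ (w ∨ y))  ≤⟨ ⊙-monoʳ (≤-trans ∨-⊙-distrib (∨-least′ ∨-upperʳ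
                                                (≤-trans ⊙≤∧ (≤-trans (≈⇒≤ (∧-comm z y)) ∨-upperˡ)))) ⟩
    ((y ∧ z) ⇒ 0#) ⊙ ((y ∧ z) ∨ w)        ≤⟨ annihilate modus-ponens ⟩
    w                                     ∎
    where open PosetReasoning ≤-poset

  relative-implication : ∀ {y z a} → ((y ∧ z) ⇒ 0#) ⊙ (z ∨ a) ≤ y ⇒ a
  relative-implication {y} {z} {a} = residual← (begin
    (((y ∧ z) ⇒ 0#) ⊙ (z ∨ a)) ⊙ y   ≈⟨ ⊙-assoc ((y ∧ z) ⇒ 0#) (z ∨ a) y ⟩
    ((y ∧ z) ⇒ 0#) ⊙ ((z ∨ a) ⊙ y)   ≤⟨ ⊙-monoʳ (≤-trans (≈⇒≤ (⊙-comm (z ∨ a) y))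
                                           (≤-trans ⊙-distribˡ-∨ (∨-mono ⊙≤∧ ⊙-lowerʳ))) ⟩
    ((y ∧ z) ⇒ 0#) ⊙ ((y ∧ z) ∨ a)   ≤⟨ annihilate modus-ponens ⟩
    a                                ∎)
    where open PosetReasoning ≤-poset

  annihilation-pullback : ∀ {g h e} → g ⊙ h ≤ 0# → h ⊙ (e ⇒ g) ≤ e ⇒ 0#
  annihilation-pullback {g} {h} {e} g⊙h≤0 = residual← (begin
    (h ⊙ (e ⇒ g)) ⊙ e   ≈⟨ ⊙-assoc h (e ⇒ g) e ⟩
    h ⊙ ((e ⇒ g) ⊙ e)   ≤⟨ ⊙-monoʳ modus-ponens ⟩
    h ⊙ g               ≈⟨ ⊙-comm h g ⟩
    g ⊙ h               ≤⟨ g⊙h≤0 ⟩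
    0#                  ∎)
    where open PosetReasoning ≤-poset

  negation≤cover : ∀ {e e′} → e ∨ e′ ≈ 1# → e ⇒ 0# ≤ e′
  negation≤cover e∨e′≈1 =
    ≤-trans (split e∨e′≈1) (∨-least′ (≤-trans modus-ponens 0≤) ⊙-lowerʳ)

  ⇒-compose : ∀ {x y z} → (x ⇒ y) ⊙ (y ⇒ z) ≤ x ⇒ z
  ⇒-compose {x} {y} {z} = residual← (begin
    ((x ⇒ y) ⊙ (y ⇒ z)) ⊙ x   ≈⟨ xy∙z≈y∙xz (x ⇒ y) (y ⇒ z) x ⟩
    (y ⇒ z) ⊙ ((x ⇒ y) ⊙ x)   ≤⟨ ⊙-monoʳ modus-ponens ⟩
    (y ⇒ z) ⊙ y               ≤⟨ modus-ponens ⟩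
    z                         ∎)
    where open PosetReasoning ≤-poset

  ⟺-compose : ∀ {x y z} → (x ⟺ y) ⊙ (y ⟺ z) ≤ x ⟺ z
  ⟺-compose {x} {y} {z} =
    ∧-greatest′ (≤-trans (⊙-mono ∧-lowerˡ ∧-lowerˡ) ⇒-compose)
                (≤-trans (⊙-mono ∧-lowerʳ ∧-lowerʳ)
                         (≤-trans (≈⇒≤ (⊙-comm (y ⇒ x) (z ⇒ y))) ⇒-compose))

  ⟺-compatible : (_∘_ : Carrier → Carrier → Carrier) →
    (∀ {x y u v} → (x ⇒ y) ⊙ (u ⇒ v) ≤ (x ∘ u) ⇒ (y ∘ v)) →
    ∀ {x y u v} → (x ⟺ y) ⊙ (u ⟺ v) ≤ (x ∘ u) ⟺ (y ∘ v)
  ⟺-compatible _∘_ mono =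
    ∧-greatest′ (≤-trans (⊙-mono ∧-lowerˡ ∧-lowerˡ) mono)
                (≤-trans (⊙-mono ∧-lowerʳ ∧-lowerʳ) mono)

  ∨-⇒-mono : ∀ {x y u v} → (x ⇒ y) ⊙ (u ⇒ v) ≤ (x ∨ u) ⇒ (y ∨ v)
  ∨-⇒-mono = residual← (≤-trans ⊙-distribˡ-∨
    (∨-mono (≤-trans (⊙-monoˡ ⊙-lowerˡ) modus-ponens) (≤-trans (⊙-monoˡ ⊙-lowerʳ) modus-ponens)))

  ∧-⇒-mono : ∀ {x y u v} → (x ⇒ y) ⊙ (u ⇒ v) ≤ (x ∧ u) ⇒ (y ∧ v)
  ∧-⇒-mono = residual← (∧-greatest′
    (≤-trans (⊙-mono ⊙-lowerˡ ∧-lowerˡ) modus-ponens) (≤-trans (⊙-mono ⊙-lowerʳ ∧-lowerʳ) modus-ponens))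

  ⊙-⇒-mono : ∀ {x y u v} → (x ⇒ y) ⊙ (u ⇒ v) ≤ (x ⊙ u) ⇒ (y ⊙ v)
  ⊙-⇒-mono {x} {y} {u} {v} = residual←
    (≤-trans (≈⇒≤ (interchange (x ⇒ y) (u ⇒ v) x u)) (⊙-mono modus-ponens modus-ponens))

  ⇒-⇒-mono : ∀ {x y u v} → (y ⇒ x) ⊙ (u ⇒ v) ≤ (x ⇒ u) ⇒ (y ⇒ v)
  ⇒-⇒-mono {x} {y} {u} {v} = residual← (begin
    ((y ⇒ x) ⊙ (u ⇒ v)) ⊙ (x ⇒ u)   ≈⟨ xy∙z≈xz∙y (y ⇒ x) (u ⇒ v) (x ⇒ u) ⟩
    ((y ⇒ x) ⊙ (x ⇒ u)) ⊙ (u ⇒ v)   ≤⟨ ⊙-monoˡ ⇒-compose ⟩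
    (y ⇒ u) ⊙ (u ⇒ v)               ≤⟨ ⇒-compose ⟩
    y ⇒ v                           ∎)
    where open PosetReasoning ≤-poset

  ⇒-⟺-compatible : ∀ {x y u v} → (x ⟺ y) ⊙ (u ⟺ v) ≤ (x ⇒ u) ⟺ (y ⇒ v)
  ⇒-⟺-compatible = ∧-greatest′ (≤-trans (⊙-mono ∧-lowerʳ ∧-lowerˡ) ⇒-⇒-mono)
                                (≤-trans (⊙-mono ∧-lowerˡ ∧-lowerʳ) ⇒-⇒-mono)

  -- Congruences.  A congruence is determined by its class of 1#:
  -- x θ y iff (x ⟺ y) θ 1#.

  infix 4 _⊆_
  _⊆_ : ∀ {a b} → Rel Carrier a → Rel Carrier b → Set (c ⊔ a ⊔ b)
  R ⊆ S = ∀ x y → R x y → S x y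

  rebase : ∀ {e₁ e₂} {E₁ : Rel Carrier e₁} {E₂ : Rel Carrier e₂} →
           E₂ ⊆ E₁ → CongOver A E₁ → CongOver A E₂
  rebase E₂⊆E₁ θ = record
    { rel = rel θ
    ; isEquivalence = isEquivalence θ
    ; contains = λ {x} {y} xE₂y → contains θ (E₂⊆E₁ x y xE₂y)
    ; compatible = compatible θ
    }

  module _ (θ : Congruence A) where
    open IsEquivalence (isEquivalence θ) using ()
      renaming (refl to θ-refl; sym to θ-sym; trans to θ-trans)

    respects : ∀ {x y x′ y′} → x ≈ x′ → y ≈ y′ → rel θ x y → rel θ x′ y′
    respects x≈x′ y≈y′ xθy = θ-trans (contains θ (≈-sym x≈x′)) (θ-trans xθy (contains θ y≈y′))

    compat-∨ : ∀ {x y u v} → rel θ x y → rel θ u v → rel θ (x ∨ u) (y ∨ v)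
    compat-∨ p q = proj₁ (compatible θ p q)

    compat-∧ : ∀ {x y u v} → rel θ x y → rel θ u v → rel θ (x ∧ u) (y ∧ v)
    compat-∧ p q = proj₁ (proj₂ (compatible θ p q))

    compat-⊙ : ∀ {x y u v} → rel θ x y → rel θ u v → rel θ (x ⊙ u) (y ⊙ v)
    compat-⊙ p q = proj₁ (proj₂ (proj₂ (compatible θ p q)))

    compat-⇒ : ∀ {x y u v} → rel θ x y → rel θ u v → rel θ (x ⇒ u) (y ⇒ v)
    compat-⇒ p q = proj₂ (proj₂ (proj₂ (compatible θ p q)))

    convex : ∀ {a b x} → rel θ a x → a ≤ b → b ≤ x → rel θ b x
    convex {a} {b} {x} aθx a≤b b≤x =
      respects (≤⇒∨≈ a≤b) (≈-trans (∨-comm x b) (≤⇒∨≈ b≤x)) (compat-∨ aθx (θ-refl {b}))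

    class1-up : ∀ {w v} → rel θ w 1# → w ≤ v → rel θ v 1#
    class1-up {w} {v} wθ1 w≤v = respects (≤⇒∨≈ w≤v) (≤-antisym ≤1 ∨-upperˡ) (compat-∨ wθ1 (θ-refl {v}))

    class1-⊙ : ∀ {a b} → rel θ a 1# → rel θ b 1# → rel θ (a ⊙ b) 1#
    class1-⊙ p q = respects ≈-refl (⊙-identityˡ 1#) (compat-⊙ p q)

    ⟺1-intro : ∀ {x y} → rel θ x y → rel θ (x ⟺ y) 1#
    ⟺1-intro xθy = respects ≈-refl (1#-greatest 1#)
      (compat-∧ (respects ≈-refl ⇒-self (compat-⇒ xθy θ-refl))
                (respects ≈-refl ⇒-self (compat-⇒ (θ-sym xθy) θ-refl)))

    -- x ⟺ y ∈ 1/θ gives x θ (x ∧ y) θ y: x ⊙ (x ⇒ y) θ x and, by convexity,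
    -- x ⊙ (x ⇒ y) ≤ x ∧ y ≤ x; symmetrically for y.
    ⟺1-elim : ∀ {x y} → rel θ (x ⟺ y) 1# → rel θ x y
    ⟺1-elim {x} {y} r = θ-trans (θ-sym (meet-with (class1-up r ∧-lowerˡ)))
      (respects (∧-comm y x) ≈-refl (meet-with (class1-up r ∧-lowerʳ)))
      where
      meet-with : ∀ {a b} → rel θ (a ⇒ b) 1# → rel θ (a ∧ b) a
      meet-with {a} r′ = convex (respects ≈-refl (⊙-identityʳ a) (compat-⊙ θ-refl r′))
                                (∧-greatest′ ⊙-lowerˡ modus-ponensʳ) ∧-lowerˡ

    total-if-0∼1 : rel θ 0# 1# → ∀ x y → rel θ x y
    total-if-0∼1 r x y = θ-trans (to-1 x) (θ-sym (to-1 y))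
      where
      to-1 : ∀ z → rel θ z 1#
      to-1 z = class1-up r 0≤

  infix 4 _∈_
  _∈_ : Carrier → Filter A → Set (c ⊔ ℓ)
  x ∈ 𝔽 = Filter.F 𝔽 x

  ∼ : Filter A → Rel Carrier (c ⊔ ℓ)
  ∼ = ∼[_] A

  module _ (𝔽 : Filter A) where
    ∈-up : ∀ {x y} → x ∈ 𝔽 → x ≤ y → y ∈ 𝔽
    ∈-up = Filter.up-closed 𝔽 _ _

    ∈-⊙ : ∀ {x y} → x ∈ 𝔽 → y ∈ 𝔽 → x ⊙ y ∈ 𝔽
    ∈-⊙ = Filter.⊙-closed 𝔽 _ _

    1∈ : 1# ∈ 𝔽
    1∈ = ∈-up (proj₂ (Filter.nonempty 𝔽)) ≤1

    ∈⇒∼1 : ∀ {x} → x ∈ 𝔽 → ∼ 𝔽 x 1#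
    ∈⇒∼1 x∈𝔽 = ∈-up x∈𝔽 ≤⟺1

    ∼1⇒∈ : ∀ {x} → ∼ 𝔽 x 1# → x ∈ 𝔽
    ∼1⇒∈ x∼1 = ∈-up x∼1 ⟺1≤

    ≈⇒∼ : ∀ {x y} → x ≈ y → ∼ 𝔽 x y
    ≈⇒∼ x≈y = ∈-up 1∈ (≈⇒1≤⟺ x≈y)

    ∼-sym : ∀ {x y} → ∼ 𝔽 x y → ∼ 𝔽 y x
    ∼-sym {x} {y} x∼y = ∈-up x∼y (≈⇒≤ (∧-comm (x ⇒ y) (y ⇒ x)))

    ∼-isEquivalence : IsEquivalence (∼ 𝔽)
    ∼-isEquivalence = record
      { refl = ≈⇒∼ ≈-refl
      ; sym = ∼-sym
      ; trans = λ x∼y y∼z → ∈-up (∈-⊙ x∼y y∼z) ⟺-compose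
      }

    ∼-compatible : Compatible A (∼ 𝔽)
    ∼-compatible x∼y u∼v =
        ∈-up both (⟺-compatible _∨_ ∨-⇒-mono) , ∈-up both (⟺-compatible _∧_ ∧-⇒-mono)
      , ∈-up both (⟺-compatible _⊙_ ⊙-⇒-mono) , ∈-up both ⇒-⟺-compatible
      where
      both = ∈-⊙ x∼y u∼v

  filterCong : ∀ {e} (E : Rel Carrier e) (𝔽 : Filter A) → E ⊆ ∼ 𝔽 → CongOver A E
  filterCong E 𝔽 E⊆∼ = record
    { rel = ∼ 𝔽
    ; isEquivalence = ∼-isEquivalence 𝔽
    ; contains = E⊆∼ _ _
    ; compatible = ∼-compatible 𝔽
    }

  class1 : Congruence A → Filter A
  class1 θ = record
    { F = λ w → rel θ w 1#
    ; nonempty = 1# , IsEquivalence.refl (isEquivalence θ)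
    ; ⊙-closed = λ _ _ → class1-⊙ θ
    ; up-closed = λ _ _ → class1-up θ
    }

  trivial : Filter A
  trivial = record
    { F = λ w → Lift c (1# ≤ w)
    ; nonempty = 1# , lift ≤-refl
    ; ⊙-closed = λ _ _ p q → lift (≤-trans (≈⇒≤ (≈-sym (⊙-identityˡ 1#))) (⊙-mono (lower p) (lower q)))
    ; up-closed = λ _ _ p q → lift (≤-trans (lower p) q)
    }

  ≈⇒∼trivial : _≈_ ⊆ ∼ trivial
  ≈⇒∼trivial _ _ x≈y = lift (≈⇒1≤⟺ x≈y)

  ∼trivial⇒≈ : ∼ trivial ⊆ _≈_
  ∼trivial⇒≈ _ _ x∼y = 1≤⟺⇒≈ (lower x∼y)

  -- The filter {w | t ∨ w ∈ 𝔽}.  When t is a complement of y modulo 𝔽 it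
  -- is the filter generated by 𝔽 and y.
  relative : Filter A → Carrier → Filter A
  relative 𝔽 t = record
    { F = λ w → t ∨ w ∈ 𝔽
    ; nonempty = 1# , ∈-up 𝔽 (1∈ 𝔽) ∨-upperʳ
    ; ⊙-closed = λ _ _ p q → ∈-up 𝔽 (∈-⊙ 𝔽 p q) ∨-⊙-distrib
    ; up-closed = λ _ _ p w≤v → ∈-up 𝔽 p (∨-mono ≤-refl w≤v)
    }

  relativeCong : ∀ {e} (E : Rel Carrier e) (𝔽 : Filter A) → E ⊆ ∼ 𝔽 → Carrier → CongOver A E
  relativeCong E 𝔽 E⊆∼ t = filterCong E (relative 𝔽 t) λ x y xEy → ∈-up 𝔽 (E⊆∼ x y xEy) ∨-upperʳ

  -- Joins of congruences: ∼𝔽 ∨ ∼𝔾 = ∼(𝔽 ⊔ᶠ 𝔾), where 𝔽 ⊔ᶠ 𝔾 is the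
  -- filter generated by 𝔽 ∪ 𝔾.

  infixr 6 _⊔ᶠ_
  _⊔ᶠ_ : Filter A → Filter A → Filter A
  𝔽 ⊔ᶠ 𝔾 = record
    { F = λ w → ∃[ a ] ∃[ b ] a ∈ 𝔽 × b ∈ 𝔾 × a ⊙ b ≤ w
    ; nonempty = 1# , 1# , 1# , 1∈ 𝔽 , 1∈ 𝔾 , ≤1
    ; ⊙-closed = λ { _ _ (a , b , a∈ , b∈ , a⊙b≤) (a′ , b′ , a′∈ , b′∈ , a′⊙b′≤) →
        a ⊙ a′ , b ⊙ b′ , ∈-⊙ 𝔽 a∈ a′∈ , ∈-⊙ 𝔾 b∈ b′∈ ,
        ≤-trans (≈⇒≤ (interchange a a′ b b′)) (⊙-mono a⊙b≤ a′⊙b′≤) }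
    ; up-closed = λ { _ _ (a , b , a∈ , b∈ , a⊙b≤) w≤v → a , b , a∈ , b∈ , ≤-trans a⊙b≤ w≤v }
    }

  ∼-⊔ᶠ-upperˡ : ∀ 𝔽 𝔾 → ∼ 𝔽 ⊆ ∼ (𝔽 ⊔ᶠ 𝔾)
  ∼-⊔ᶠ-upperˡ 𝔽 𝔾 x y x∼y = (x ⟺ y) , 1# , x∼y , 1∈ 𝔾 , ≈⇒≤ (⊙-identityʳ (x ⟺ y))

  ∼-⊔ᶠ-upperʳ : ∀ 𝔽 𝔾 → ∼ 𝔾 ⊆ ∼ (𝔽 ⊔ᶠ 𝔾)
  ∼-⊔ᶠ-upperʳ 𝔽 𝔾 x y x∼y = 1# , (x ⟺ y) , 1∈ 𝔽 , x∼y , ≈⇒≤ (⊙-identityˡ (x ⟺ y))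

  ∼-⊔ᶠ-least : ∀ 𝔽 𝔾 (γ : Congruence A) → ∼ 𝔽 ⊆ rel γ → ∼ 𝔾 ⊆ rel γ → ∼ (𝔽 ⊔ᶠ 𝔾) ⊆ rel γ
  ∼-⊔ᶠ-least 𝔽 𝔾 γ 𝔽⊆γ 𝔾⊆γ x y (a , b , a∈𝔽 , b∈𝔾 , a⊙b≤x⟺y) =
    ⟺1-elim γ (class1-up γ (class1-⊙ γ (𝔽⊆γ a 1# (∈⇒∼1 𝔽 a∈𝔽)) (𝔾⊆γ b 1# (∈⇒∼1 𝔾 b∈𝔾))) a⊙b≤x⟺y)

  ∼-⊔ᶠ-reached : ∀ {e} {E : Rel Carrier e} 𝔽 𝔾 → E ⊆ ∼ 𝔽 → ∀ {x y} →
    (∀ (γ : CongOver A E) → ∼ 𝔽 ⊆ rel γ → ∼ 𝔾 ⊆ rel γ → rel γ x y) → ∼ (𝔽 ⊔ᶠ 𝔾) x y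
  ∼-⊔ᶠ-reached {E = E} 𝔽 𝔾 E⊆∼𝔽 in-every-upper-bound =
    in-every-upper-bound (filterCong E (𝔽 ⊔ᶠ 𝔾) λ x y xEy → ∼-⊔ᶠ-upperˡ 𝔽 𝔾 x y (E⊆∼𝔽 x y xEy))
                         (∼-⊔ᶠ-upperˡ 𝔽 𝔾) (∼-⊔ᶠ-upperʳ 𝔽 𝔾)

  -- Complemented congruences.  Throughout, E is the equality of the
  -- quotient under consideration (≈ for A, ∼𝔽 for A/𝔽), so ≈ ⊆ E.

  module _ {e} {E : Rel Carrier e} (≈⊆E : _≈_ ⊆ E) where

    forget : CongOver A E → Congruence A
    forget = rebase ≈⊆E

    -- If R and S have total join, some g ∈ 1/R and h ∈ 1/S satisfy
    -- g ⊙ h ≤ 0#: the join of the filters 1/R and 1/S contains 0# ⟺ 1#.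
    complement-witnesses : (R S : CongOver A E) →
      (∀ (γ : CongOver A E) → rel R ⊆ rel γ → rel S ⊆ rel γ → ∀ x y → rel γ x y) →
      ∃[ g ] ∃[ h ] rel R g 1# × rel S h 1# × g ⊙ h ≤ 0#
    complement-witnesses R S total-join =
      let g , h , g∈R , h∈S , g⊙h≤0⟺1 = 0∼1-in-join in g , h , g∈R , h∈S , ≤-trans g⊙h≤0⟺1 ⟺1≤
      where
      0∼1-in-join : ∼ (class1 (forget R) ⊔ᶠ class1 (forget S)) 0# 1#
      0∼1-in-join = ∼-⊔ᶠ-reached (class1 (forget R)) (class1 (forget S))
        (λ x y xEy → ⟺1-intro (forget R) (contains R xEy))
        (λ γ 1/R⊆γ 1/S⊆γ → total-join γ (λ x y p → 1/R⊆γ x y (⟺1-intro (forget R) p))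
                                        (λ x y q → 1/S⊆γ x y (⟺1-intro (forget S) q)) 0# 1#)

    classes-cover : (R S : CongOver A E) → (∀ x y → rel R x y → rel S x y → E x y) →
      ∀ {w v} → rel R w 1# → rel S v 1# → E (w ∨ v) 1#
    classes-cover R S meet w∈R v∈S =
      meet _ _ (class1-up (forget R) w∈R ∨-upperˡ) (class1-up (forget S) v∈S ∨-upperʳ)

  relative-complemented : ∀ {e} {E : Rel Carrier e} (𝔽 : Filter A) (E⊆∼ : E ⊆ ∼ 𝔽) → ∼ 𝔽 ⊆ E →
    ∀ {y z} → ∼ 𝔽 (y ∨ z) 1# → ∼ 𝔽 (y ∧ z) 0# → ComplementedCon A E (relativeCong E 𝔽 E⊆∼ z)
  relative-complemented {E = E} 𝔽 E⊆∼ ∼⊆E {y} {z} y∨z∼1 y∧z∼0 =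
      relativeCong E 𝔽 E⊆∼ y , meet , join
    where
    y∨z∈𝔽 : y ∨ z ∈ 𝔽
    y∨z∈𝔽 = ∼1⇒∈ 𝔽 y∨z∼1

    meet : ∀ x x′ → z ∨ (x ⟺ x′) ∈ 𝔽 → y ∨ (x ⟺ x′) ∈ 𝔽 → E x x′
    meet x x′ p q = ∼⊆E x x′ (∈-up 𝔽 (∈-⊙ 𝔽 (∈-up 𝔽 y∧z∼0 ∧-lowerˡ) (∈-⊙ 𝔽 p q)) relative-meet)

    join : ∀ (γ : CongOver A E) → ∼ (relative 𝔽 z) ⊆ rel γ → ∼ (relative 𝔽 y) ⊆ rel γ →
           ∀ x x′ → rel γ x x′
    join γ z-part y-part = total-if-0∼1 γ̂
        (IsEquivalence.trans (isEquivalence γ) (contains γ (∼⊆E _ _ (∼-sym 𝔽 y∧z∼0))) y∧z∼1)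
      where
      γ̂ : Congruence A
      γ̂ = forget (λ x x′ x≈x′ → ∼⊆E x x′ (≈⇒∼ 𝔽 x≈x′)) γ
      y∼1 : rel γ y 1#
      y∼1 = z-part y 1# (∈-up 𝔽 y∨z∈𝔽 (≤-trans (≈⇒≤ (∨-comm y z)) (∨-mono ≤-refl ≤⟺1)))
      z∼1 : rel γ z 1#
      z∼1 = y-part z 1# (∈-up 𝔽 y∨z∈𝔽 (∨-mono ≤-refl ≤⟺1))
      y∧z∼1 : rel γ (y ∧ z) 1#
      y∧z∼1 = respects γ̂ ≈-refl (1#-greatest 1#) (compat-∧ γ̂ y∼1 z∼1)

  complemented-principal : (α : Congruence A) → ComplementedCon A _≈_ α →
    ∃[ a ] Complemented A _≈_ a × rel α a 1# × (∀ w → rel α w 1# → a ≤ w)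
  complemented-principal α (α′ , meet , total-join) =
    let a , b , a∈α , b∈α′ , a⊙b≤0 = complement-witnesses ≈⊆≈ α α′ total-join
        covers : ∀ w → rel α w 1# → w ∨ b ≈ 1#
        covers w w∈α = classes-cover ≈⊆≈ α α′ meet w∈α b∈α′
        a∨b≈1 = covers a a∈α
    in a , (b , a∨b≈1 , 1≤⟺⇒≈ (≤-trans (≈⇒≤ (≈-sym a∨b≈1)) (join≤meet⟺0 a⊙b≤0))) , a∈α ,
       λ w w∈α → below-if-covers a⊙b≤0 (≈⇒≤ (≈-sym (≈-trans (∨-comm b w) (covers w w∈α))))
    where
    ≈⊆≈ : _≈_ ⊆ _≈_
    ≈⊆≈ _ _ x≈y = x≈y

  -- The congruence of a complemented e (its filter ↑e, presented as
  -- {w | e′ ∨ w ≈ 1#}) joined with ∼𝔽 is β, as soon as e ∈ 1/β and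
  -- e′ ∨ w ∈ 𝔽 for every w ∈ 1/β.
  boolean-join : ∀ (𝔽 : Filter A) (β : CongOver A (∼ 𝔽)) {e e′} →
    e ∨ e′ ≈ 1# → e ∧ e′ ≈ 0# → rel β e 1# → (∀ w → rel β w 1# → e′ ∨ w ∈ 𝔽) →
    IsJoin A (relativeCong _≈_ trivial ≈⇒∼trivial e′) (∼ 𝔽) (rel β)
  boolean-join 𝔽 β {e} {e′} e∨e′≈1 e∧e′≈0 e∈β covered = α⊆β , (λ _ _ → contains β) , least
    where
    β̂ : Congruence A
    β̂ = forget (λ _ _ → ≈⇒∼ 𝔽) β
    e⊙e′≤0 : e ⊙ e′ ≤ 0#
    e⊙e′≤0 = ≤-trans ⊙≤∧ (≈⇒≤ e∧e′≈0)

    α⊆β : ∀ x y → Lift c (1# ≤ e′ ∨ (x ⟺ y)) → rel β x y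
    α⊆β x y (lift 1≤e′∨w) = ⟺1-elim β̂ (class1-up β̂ e∈β (below-if-covers e⊙e′≤0 1≤e′∨w))

    -- Every x β y is witnessed in the join filter by e and e ⇒ (x ⟺ y) ∈ 𝔽.
    least : ∀ (γ : Congruence A) → ∼ (relative trivial e′) ⊆ rel γ → ∼ 𝔽 ⊆ rel γ → rel β ⊆ rel γ
    least γ α⊆γ 𝔽⊆γ x y xβy = ∼-⊔ᶠ-least (relative trivial e′) 𝔽 γ α⊆γ 𝔽⊆γ x y
      (e , e ⇒ (x ⟺ y) , lift (≈⇒≤ (≈-sym (≈-trans (∨-comm e′ e) e∨e′≈1))) ,
       ∈-up 𝔽 (covered (x ⟺ y) (⟺1-intro β̂ xβy))
              (residual← (≤-trans (≈⇒≤ (⊙-comm (e′ ∨ (x ⟺ y)) e)) (annihilate e⊙e′≤0))) ,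
       modus-ponensʳ)

  blp⇒cblp : ∀ (𝔽 : Filter A) → BLP A 𝔽 → CBLP A (∼ 𝔽)
  blp⇒cblp 𝔽 blp β (S , meet , total-join) =
    let g , h , g∈β , h∈S , g⊙h≤0 = complement-witnesses ≈⊆∼ β S total-join
        g∨h∈𝔽 = ∼1⇒∈ 𝔽 (classes-cover ≈⊆∼ β S meet g∈β h∈S)
        e , (e′ , e∨e′≈1 , e∧e′≈0) , e∼g =
          blp g (h , ∈⇒∼1 𝔽 g∨h∈𝔽 , ∈-up 𝔽 g∨h∈𝔽 (join≤meet⟺0 g⊙h≤0))
        -- e′ ∈ 1/S because h ∈ 1/S, e ⇒ g ∈ 𝔽 and h ⊙ (e ⇒ g) ≤ e ⇒ 0# ≤ e′
        e′∈S : rel S e′ 1#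
        e′∈S = class1-up (forget ≈⊆∼ S)
          (class1-⊙ (forget ≈⊆∼ S) h∈S (contains S (∈⇒∼1 𝔽 (∈-up 𝔽 e∼g ∧-lowerˡ))))
          (≤-trans (annihilation-pullback g⊙h≤0) (negation≤cover e∨e′≈1))
    in relativeCong _≈_ trivial ≈⇒∼trivial e′ ,
       relative-complemented trivial ≈⇒∼trivial ∼trivial⇒≈
         (≈⇒∼trivial _ _ e∨e′≈1) (≈⇒∼trivial _ _ e∧e′≈0) ,
       boolean-join 𝔽 β e∨e′≈1 e∧e′≈0
         (IsEquivalence.trans (isEquivalence β) (contains β e∼g) g∈β)
         (λ w w∈β → ∼1⇒∈ 𝔽 (classes-cover ≈⊆∼ S β meet′ e′∈S w∈β))
    where
    ≈⊆∼ : _≈_ ⊆ ∼ 𝔽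
    ≈⊆∼ _ _ = ≈⇒∼ 𝔽
    meet′ : ∀ x y → rel S x y → rel β x y → ∼ 𝔽 x y
    meet′ x y s r = meet x y r s

  cblp⇒blp : ∀ (𝔽 : Filter A) → CBLP A (∼ 𝔽) → BLP A 𝔽
  cblp⇒blp 𝔽 cblp y (z , y∨z∼1 , y∧z∼0) =
    let α , α-complemented , α⊆β , _ , β-least = cblp β (relative-complemented 𝔽 ∼⊆∼ ∼⊆∼ y∨z∼1 y∧z∼0)
        a , a-complemented , a∈α , a-least = complemented-principal α α-complemented
        -- y ∈ 1/β lies in the join of 1/α and 𝔽: y ⟺ 1# ≥ a₀ ⊙ f
        a₀ , f , a₀∈α , f∈𝔽 , a₀⊙f≤ = ∼-⊔ᶠ-reached {E = _≈_} (class1 α) 𝔽 (λ _ _ x≈y → ⟺1-intro α (contains α x≈y))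
          (λ γ 1/α⊆γ 𝔽⊆γ → β-least γ (λ x x′ p → 1/α⊆γ x x′ (⟺1-intro α p)) 𝔽⊆γ y 1# y∈β)
        a⇒y∈𝔽 : a ⇒ y ∈ 𝔽
        a⇒y∈𝔽 = ∈-up 𝔽 f∈𝔽 (residual← (≤-trans (⊙-monoʳ (a-least a₀ a₀∈α))
                   (≤-trans (≈⇒≤ (⊙-comm f a₀)) (≤-trans a₀⊙f≤ ⟺1≤))))
        -- a ∈ 1/β means z ∨ a ∈ 𝔽
        y⇒a∈𝔽 : y ⇒ a ∈ 𝔽
        y⇒a∈𝔽 = ∈-up 𝔽 (∈-⊙ 𝔽 (∈-up 𝔽 y∧z∼0 ∧-lowerˡ) (∈-up 𝔽 (α⊆β a 1# a∈α) (∨-mono ≤-refl ⟺1≤)))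
                  relative-implication
    in a , a-complemented , ∈-up 𝔽 (∈-⊙ 𝔽 a⇒y∈𝔽 y⇒a∈𝔽) ⊙≤∧
    where
    ∼⊆∼ : ∼ 𝔽 ⊆ ∼ 𝔽
    ∼⊆∼ _ _ x∼y = x∼y
    β : CongOver A (∼ 𝔽)
    β = relativeCong (∼ 𝔽) 𝔽 ∼⊆∼ z
    y∈β : rel β y 1#
    y∈β = ∈-up 𝔽 (∼1⇒∈ 𝔽 y∨z∼1) (≤-trans (≈⇒≤ (∨-comm y z)) (∨-mono ≤-refl ≤⟺1))

  cblp-transport : ∀ {θ θ′ : Rel Carrier (c ⊔ ℓ)} → θ ⊆ θ′ → θ′ ⊆ θ → CBLP A θ → CBLP A θ′
  cblp-transport θ⊆θ′ θ′⊆θ cblp β (S , meet , total-join) =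
    let α , α-complemented , α⊆β , θ⊆β , β-least =
          cblp (rebase θ⊆θ′ β)
               (rebase θ⊆θ′ S , (λ x y p q → θ′⊆θ x y (meet x y p q)) ,
                λ γ → total-join (rebase θ′⊆θ γ))
    in α , α-complemented , α⊆β , (λ x y p → θ⊆β x y (θ′⊆θ x y p)) ,
       λ γ α⊆γ θ′⊆γ → β-least γ α⊆γ (λ x y p → θ′⊆γ x y (θ⊆θ′ x y p))

  hasBLP⇒hasCBLP : HasBLP A → HasCBLP A
  hasBLP⇒hasCBLP blp θ =
    cblp-transport (λ _ _ → ⟺1-elim θ) (λ _ _ → ⟺1-intro θ) (blp⇒cblp (class1 θ) (blp (class1 θ)))

  hasCBLP⇒hasBLP : HasCBLP A → HasBLP A
  hasCBLP⇒hasBLP cblp 𝔽 = cblp⇒blp 𝔽 (cblp (filterCong _≈_ 𝔽 λ _ _ → ≈⇒∼ 𝔽))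

proposition5p9 : ∀ {c ℓ} (A : ResiduatedLattice c ℓ) →
    (∀ (𝔽 : Filter A) → BLP A 𝔽 ⇔ CBLP A (∼[_] A 𝔽))
    × (HasBLP A ⇔ HasCBLP A)
proposition5p9 A =
    (λ 𝔽 → mk⇔ (blp⇒cblp A 𝔽) (cblp⇒blp A 𝔽))
  , mk⇔ (hasBLP⇒hasCBLP A) (hasCBLP⇒hasBLP A)
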